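{- Let $\mathcal{C}$ be a category with finite products and weak pullbacks. The functor $F\colon\mathcal{C}\to\mathrm{Span}^{\sim}(\mathcal{C})$, identity on objects and sending $f\colon X\to Y$ to the class of $X\xleftarrow{\mathrm{id}_X}X\xrightarrow{f}Y$, corestricts to an isomorphism of categories $\mathcal{C}\cong\mathrm{Map}(\mathrm{Span}^{\sim}(\mathcal{C}))$. Moreover, the surjective maps of $\mathrm{Span}^{\sim}(\mathcal{C})$ are exactly the images under $F$ of the split epimorphisms of $\mathcal{C}$.
   Context: Composition is diagrammatic ($R;S$ means first $R$ then $S$). A weak pullback is a commutative square satisfying the existence (not necessarily uniqueness) part of the pullback universal property. $\mathrm{Span}^{\sim}(\mathcal{C})$: for spans $X\leftarrow A\to Y$ in $\mathcal{C}$ set $(X\leftarrow A\to Y)\le(X\leftarrow B\to Y)$ iff some $\alpha\colon A\to B$ commutes with both legs; $s_1\sim s_2$ iff $s_1\le s_2\le s_1$. Objects are those of $\mathcal{C}$, morphisms are $\sim$-classes of spans ordered by $\le$, composition via weak pullbacks, identities $X\xleftarrow{\mathrm{id}}X\xrightarrow{\mathrm{id}}X$, monoidal product the product of $\mathcal{C}$ with unit $1$, $\delta_X=[X\xleftarrow{\mathrm{id}}X\xrightarrow{\Delta}X\times X]$, $\varepsilon_X=[X\xleftarrow{\mathrm{id}}X\to1]$, and $\delta_X^*,\varepsilon_X^*$ the reversed spans; this is a cartesian bicategory (a poset-enriched symmetric monoidal category with these data satisfying the cartesian bicategory axioms). In a cartesian bicategory, for $R\colon X\to Y$: $R$ is single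 valued if $\delta_X;(R\otimes R)\le R;\delta_Y$, total if $\varepsilon_X\le R;\varepsilon_Y$, surjective if $\varepsilon_Y^*\le\varepsilon_X^*;R$; a map is a single valued total morphism; $\mathrm{Map}(-)$ denotes the subcategory of maps. -}

module Defs where

open import Level using (Level; _⊔_) renaming (suc to lsuc)
open import Relation.Binary using (Rel; IsEquivalence)
open import Data.Product using (Σ; _×_; _,_)

-- A (setoid-enriched) category; composition is DIAGRAMMATIC: f ⨾ g = "first f then g".
record Category (o m e : Level) : Set (lsuc (o ⊔ m ⊔ e)) where
  infixr 9 _⨾_
  infix 4 _≈_
  field
    Obj   : Set o
    Hom   : Obj → Obj → Set m
    _≈_   : ∀ {A B} → Rel (Hom A B) e
    id    : ∀ {A} → Hom A A
    _⨾_   : ∀ {A B C} → Hom A B → Hom B C → Hom A C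
    ≈-equiv : ∀ {A B} → IsEquivalence (_≈_ {A} {B})
    ⨾-resp  : ∀ {A B C} {f f' : Hom A B} {g g' : Hom B C} →
              f ≈ f' → g ≈ g' → f ⨾ g ≈ f' ⨾ g'
    identityˡ : ∀ {A B} {f : Hom A B} → id ⨾ f ≈ f
    identityʳ : ∀ {A B} {f : Hom A B} → f ⨾ id ≈ f
    assoc     : ∀ {A B C D} {f : Hom A B} {g : Hom B C} {h : Hom C D} →
                (f ⨾ g) ⨾ h ≈ f ⨾ (g ⨾ h)

record FiniteProducts {o m e} (C : Category o m e) : Set (o ⊔ m ⊔ e) where
  open Category C
  field
    𝟙        : Obj
    !        : ∀ {A} → Hom A 𝟙
    !-unique : ∀ {A} (f : Hom A 𝟙) → f ≈ !
    _⊗₀_     : Obj → Obj → Obj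
    π₁       : ∀ {A B} → Hom (A ⊗₀ B) A
    π₂       : ∀ {A B} → Hom (A ⊗₀ B) B
    ⟨_,_⟩    : ∀ {Q A B} → Hom Q A → Hom Q B → Hom Q (A ⊗₀ B)
    π₁-β     : ∀ {Q A B} {f : Hom Q A} {g : Hom Q B} → ⟨ f , g ⟩ ⨾ π₁ ≈ f
    π₂-β     : ∀ {Q A B} {f : Hom Q A} {g : Hom Q B} → ⟨ f , g ⟩ ⨾ π₂ ≈ g
    ⟨⟩-unique : ∀ {Q A B} {f : Hom Q A} {g : Hom Q B} (h : Hom Q (A ⊗₀ B)) →
                h ⨾ π₁ ≈ f → h ⨾ π₂ ≈ g → h ≈ ⟨ f , g ⟩

record WeakPullback {o m e} (C : Category o m e) {A B Z : Category.Obj C}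
       (f : Category.Hom C A Z) (g : Category.Hom C B Z) : Set (o ⊔ m ⊔ e) where
  open Category C
  field
    P    : Obj
    p₁   : Hom P A
    p₂   : Hom P B
    commute : p₁ ⨾ f ≈ p₂ ⨾ g
    weak-universal : ∀ {Q} (q₁ : Hom Q A) (q₂ : Hom Q B) → q₁ ⨾ f ≈ q₂ ⨾ g →
                     Σ (Hom Q P) (λ u → (u ⨾ p₁ ≈ q₁) × (u ⨾ p₂ ≈ q₂))

WeakPullbacks : ∀ {o m e} → Category o m e → Set (o ⊔ m ⊔ e)
WeakPullbacks C = ∀ {A B Z} (f : Hom A Z) (g : Hom B Z) → WeakPullback C f g
  where open Category C

-- Span~(C), working with representative spans; morphisms of Span~(C) are
-- ∼-classes of spans, and all predicates below are stated on representatives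
-- (they are invariant under ∼ because composition/⊗ are monotone).
module SpanCat {o m e} (C : Category o m e) (FP : FiniteProducts C)
               (WP : WeakPullbacks C) where
  open Category C
  open FiniteProducts FP

  record Span (X Y : Obj) : Set (o ⊔ m) where
    constructor span
    field
      apex  : Obj
      left  : Hom apex X
      right : Hom apex Y
  open Span public

  infix 4 _≤_ _∼_
  _≤_ : ∀ {X Y} → Span X Y → Span X Y → Set (m ⊔ e)
  R ≤ S = Σ (Hom (apex R) (apex S)) λ α → (α ⨾ left S ≈ left R) × (α ⨾ right S ≈ right R)

  _∼_ : ∀ {X Y} → Span X Y → Span X Y → Set (m ⊔ e)
  R ∼ S = (R ≤ S) × (S ≤ R)

  idˢ : ∀ {X} → Span X X
  idˢ {X} = span X id id

  infixr 9 _⨾ˢ_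
  _⨾ˢ_ : ∀ {X Y Z} → Span X Y → Span Y Z → Span X Z
  R ⨾ˢ S = span (WeakPullback.P W) (WeakPullback.p₁ W ⨾ left R) (WeakPullback.p₂ W ⨾ right S)
    where W = WP (right R) (left S)

  _×₁_ : ∀ {A B A' B'} → Hom A B → Hom A' B' → Hom (A ⊗₀ A') (B ⊗₀ B')
  f ×₁ g = ⟨ π₁ ⨾ f , π₂ ⨾ g ⟩

  _⊗ˢ_ : ∀ {X Y X' Y'} → Span X Y → Span X' Y' → Span (X ⊗₀ X') (Y ⊗₀ Y')
  R ⊗ˢ S = span (apex R ⊗₀ apex S) (left R ×₁ left S) (right R ×₁ right S)

  _ᵒ : ∀ {X Y} → Span X Y → Span Y X
  R ᵒ = span (apex R) (right R) (left R)

  δ : ∀ X → Span X (X ⊗₀ X)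
  δ X = span X id ⟨ id , id ⟩

  ε : ∀ X → Span X 𝟙
  ε X = span X id !

  δ* : ∀ X → Span (X ⊗₀ X) X
  δ* X = (δ X) ᵒ

  ε* : ∀ X → Span 𝟙 X
  ε* X = (ε X) ᵒ

  SingleValued : ∀ {X Y} → Span X Y → Set (m ⊔ e)
  SingleValued {X} {Y} R = (δ X ⨾ˢ (R ⊗ˢ R)) ≤ (R ⨾ˢ δ Y)

  Total : ∀ {X Y} → Span X Y → Set (m ⊔ e)
  Total {X} {Y} R = ε X ≤ (R ⨾ˢ ε Y)

  Surjective : ∀ {X Y} → Span X Y → Set (m ⊔ e)
  Surjective {X} {Y} R = ε* Y ≤ (ε* X ⨾ˢ R)

  IsMap : ∀ {X Y} → Span X Y → Set (m ⊔ e)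
  IsMap R = SingleValued R × Total R

  F : ∀ {X Y} → Hom X Y → Span X Y
  F {X} f = span X id f

  SplitEpi : ∀ {X Y} → Hom X Y → Set (m ⊔ e)
  SplitEpi {X} {Y} f = Σ (Hom Y X) λ s → s ⨾ f ≈ id

-- A span X ← A → Y is a map exactly when it is the graph of a morphism:
-- totality says that the left leg l has a section s, single-valuedness that
-- the right leg r is constant on the fibres of l, so r = l ⨾ (s ⨾ r) and the
-- span is equivalent to F (s ⨾ r). Dually, surjectivity says that r has a
-- section, which transfers to the morphism the span is the graph of.
module Submission where

open import Defs
open import Data.Product using (Σ; _×_; _,_; proj₁; proj₂)
open import Function.Bundles using (_⇔_; mk⇔; Equivalence)
open import Relation.Binary using (Setoid; IsEquivalence)
import Relation.Binary.Reasoning.Setoid as SetoidReasoning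

module MapsOfSpans {o m e} (C : Category o m e) (FP : FiniteProducts C)
                   (WP : WeakPullbacks C) where
  open Category C
  open FiniteProducts FP
  open SpanCat C FP WP

  module ≈ {A B} = IsEquivalence (≈-equiv {A} {B})

  hom-setoid : Obj → Obj → Setoid m e
  hom-setoid A B = record { Carrier = Hom A B ; _≈_ = _≈_ ; isEquivalence = ≈-equiv }

  module HomReasoning {A B} = SetoidReasoning (hom-setoid A B)
  open HomReasoning

  ⨾-congˡ : ∀ {A B D} {h : Hom A B} {f g : Hom B D} → f ≈ g → h ⨾ f ≈ h ⨾ g
  ⨾-congˡ = ⨾-resp ≈.refl

  ⨾-congʳ : ∀ {A B D} {f g : Hom A B} {h : Hom B D} → f ≈ g → f ⨾ h ≈ g ⨾ h
  ⨾-congʳ p = ⨾-resp p ≈.refl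

  !-irrelevant : ∀ {A} {f g : Hom A 𝟙} → f ≈ g
  !-irrelevant {f = f} {g} = ≈.trans (!-unique f) (≈.sym (!-unique g))

  ⟨⟩-cong : ∀ {Q A B} {a a′ : Hom Q A} {b b′ : Hom Q B} → a ≈ a′ → b ≈ b′ → ⟨ a , b ⟩ ≈ ⟨ a′ , b′ ⟩
  ⟨⟩-cong a≈a′ b≈b′ = ⟨⟩-unique _ (≈.trans π₁-β a≈a′) (≈.trans π₂-β b≈b′)

  ⟨⟩-injective : ∀ {Q A B} {a c : Hom Q A} {b d : Hom Q B} →
                 ⟨ a , b ⟩ ≈ ⟨ c , d ⟩ → (a ≈ c) × (b ≈ d)
  ⟨⟩-injective eq = ≈.trans (≈.sym π₁-β) (≈.trans (⨾-congʳ eq) π₁-β)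
                  , ≈.trans (≈.sym π₂-β) (≈.trans (⨾-congʳ eq) π₂-β)

  ⨾-⟨⟩ : ∀ {P Q A B} {h : Hom P Q} {a : Hom Q A} {b : Hom Q B} → h ⨾ ⟨ a , b ⟩ ≈ ⟨ h ⨾ a , h ⨾ b ⟩
  ⨾-⟨⟩ = ⟨⟩-unique _ (≈.trans assoc (⨾-congˡ π₁-β)) (≈.trans assoc (⨾-congˡ π₂-β))

  ⨾-diagonal : ∀ {Q A} {h : Hom Q A} → h ⨾ ⟨ id , id ⟩ ≈ ⟨ h , h ⟩
  ⨾-diagonal = ≈.trans ⨾-⟨⟩ (⟨⟩-cong identityʳ identityʳ)

  ⟨⟩-⨾-×₁ : ∀ {Q A B A′ B′} {a : Hom Q A} {b : Hom Q A′} {f : Hom A B} {g : Hom A′ B′} →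
            ⟨ a , b ⟩ ⨾ (f ×₁ g) ≈ ⟨ a ⨾ f , b ⨾ g ⟩
  ⟨⟩-⨾-×₁ = ≈.trans ⨾-⟨⟩ (⟨⟩-cong (≈.trans (≈.sym assoc) (⨾-congʳ π₁-β))
                                  (≈.trans (≈.sym assoc) (⨾-congʳ π₂-β)))

  diagonal-square : ∀ {Q A B A′} {h : Hom Q A} {k : Hom Q (B ⊗₀ A′)} {f : Hom B A} {g : Hom A′ A} →
                    h ⨾ ⟨ id , id ⟩ ≈ k ⨾ (f ×₁ g) → (h ≈ k ⨾ π₁ ⨾ f) × (h ≈ k ⨾ π₂ ⨾ g)
  diagonal-square sq = ⟨⟩-injective (≈.trans (≈.sym ⨾-diagonal) (≈.trans sq ⨾-⟨⟩))

  module _ {A B} {f : Hom A B} (W : WeakPullback C f id) where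
    open WeakPullback W

    lift-along-p₁ : ∀ {Q} (q : Hom Q A) → Σ (Hom Q P) λ u → (u ⨾ p₁ ≈ q) × (u ⨾ p₂ ≈ q ⨾ f)
    lift-along-p₁ q = weak-universal q (q ⨾ f) (≈.sym identityʳ)

  module _ {A B} {g : Hom B A} (W : WeakPullback C id g) where
    open WeakPullback W

    lift-along-p₂ : ∀ {Q} (q : Hom Q B) → Σ (Hom Q P) λ u → (u ⨾ p₁ ≈ q ⨾ g) × (u ⨾ p₂ ≈ q)
    lift-along-p₂ q = weak-universal (q ⨾ g) q identityʳ

  ≤-refl : ∀ {X Y} {R : Span X Y} → R ≤ R
  ≤-refl = id , identityˡ , identityˡ

  ∼-refl : ∀ {X Y} {R : Span X Y} → R ∼ R
  ∼-refl = ≤-refl , ≤-refl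

  ≤F⇔factors : ∀ {X Y} {R : Span X Y} {f : Hom X Y} → R ≤ F f ⇔ (left R ⨾ f ≈ right R)
  ≤F⇔factors {R = R} {f} = mk⇔ to (λ eq → left R , identityʳ , eq)
    where
    to : R ≤ F f → left R ⨾ f ≈ right R
    to (α , αid , αf) = ≈.trans (⨾-congʳ (≈.trans (≈.sym αid) identityʳ)) αf

  ≤-splitEpi-right : ∀ {X Y} {R S : Span X Y} → R ≤ S → SplitEpi (right R) → SplitEpi (right S)
  ≤-splitEpi-right (α , _ , αr) (σ , σr) = σ ⨾ α , ≈.trans assoc (≈.trans (⨾-congˡ αr) σr)

  total⇔splitEpi-left : ∀ {X Y} {R : Span X Y} → Total R ⇔ SplitEpi (left R)
  total⇔splitEpi-left {Y = Y} {R} = mk⇔ to from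
    where
    open WeakPullback (WP (right R) (id {Y}))
    to : Total R → SplitEpi (left R)
    to (α , αl , _) = α ⨾ p₁ , ≈.trans assoc αl
    from : SplitEpi (left R) → Total R
    from (s , sl) with lift-along-p₁ (WP (right R) id) s
    ... | u , up₁ , _ = u , ≈.trans (≈.sym assoc) (≈.trans (⨾-congʳ up₁) sl) , !-irrelevant

  surjective⇔splitEpi-right : ∀ {X Y} {R : Span X Y} → Surjective R ⇔ SplitEpi (right R)
  surjective⇔splitEpi-right {X} {R = R} = mk⇔ to from
    where
    open WeakPullback (WP (id {X}) (left R))
    to : Surjective R → SplitEpi (right R)
    to (α , _ , αr) = α ⨾ p₂ , ≈.trans assoc αr
    from : SplitEpi (right R) → Surjective R
    from (σ , σr) with lift-along-p₂ (WP id (left R)) σ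
    ... | u , _ , up₂ = u , !-irrelevant , ≈.trans (≈.sym assoc) (≈.trans (⨾-congʳ up₂) σr)

  factors⇒singleValued : ∀ {X Y} {R : Span X Y} {f : Hom X Y} → left R ⨾ f ≈ right R → SingleValued R
  factors⇒singleValued {Y = Y} {R} {f} lf≈r = from-lift (lift-along-p₁ (WP r id) (p₂ ⨾ π₁))
    where
    l = left R
    r = right R
    open WeakPullback (WP ⟨ id , id ⟩ (l ×₁ l))
    module G = WeakPullback (WP r (id {Y}))

    fibre-image : ∀ {k : Hom P (apex R)} → p₁ ≈ k ⨾ l → p₁ ⨾ f ≈ k ⨾ r
    fibre-image {k} p₁≈kl = begin
      p₁ ⨾ f       ≈⟨ ⨾-congʳ p₁≈kl ⟩
      (k ⨾ l) ⨾ f  ≈⟨ assoc ⟩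
      k ⨾ l ⨾ f    ≈⟨ ⨾-congˡ lf≈r ⟩
      k ⨾ r        ∎

    in-fibre : (p₁ ≈ p₂ ⨾ π₁ ⨾ l) × (p₁ ≈ p₂ ⨾ π₂ ⨾ l)
    in-fibre = diagonal-square commute

    same-image : (p₂ ⨾ π₁) ⨾ r ≈ (p₂ ⨾ π₂) ⨾ r
    same-image = ≈.trans (≈.sym (fibre-image (≈.trans (proj₁ in-fibre) (≈.sym assoc))))
                         (fibre-image (≈.trans (proj₂ in-fibre) (≈.sym assoc)))

    from-lift : Σ (Hom P G.P) (λ u → (u ⨾ G.p₁ ≈ p₂ ⨾ π₁) × (u ⨾ G.p₂ ≈ (p₂ ⨾ π₁) ⨾ r)) →
                SingleValued R
    from-lift (β , βp₁ , βp₂) = β , left-eq , right-eq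
      where
      left-eq : β ⨾ G.p₁ ⨾ l ≈ p₁ ⨾ id
      left-eq = begin
        β ⨾ G.p₁ ⨾ l      ≈⟨ ≈.sym assoc ⟩
        (β ⨾ G.p₁) ⨾ l    ≈⟨ ⨾-congʳ βp₁ ⟩
        (p₂ ⨾ π₁) ⨾ l     ≈⟨ assoc ⟩
        p₂ ⨾ π₁ ⨾ l       ≈⟨ ≈.sym (proj₁ in-fibre) ⟩
        p₁                ≈⟨ ≈.sym identityʳ ⟩
        p₁ ⨾ id           ∎
      right-eq : β ⨾ G.p₂ ⨾ ⟨ id , id ⟩ ≈ p₂ ⨾ (r ×₁ r)
      right-eq = begin
        β ⨾ G.p₂ ⨾ ⟨ id , id ⟩                  ≈⟨ ≈.sym assoc ⟩
        (β ⨾ G.p₂) ⨾ ⟨ id , id ⟩                ≈⟨ ⨾-diagonal ⟩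
        ⟨ β ⨾ G.p₂ , β ⨾ G.p₂ ⟩                 ≈⟨ ⟨⟩-cong βp₂ (≈.trans βp₂ same-image) ⟩
        ⟨ (p₂ ⨾ π₁) ⨾ r , (p₂ ⨾ π₂) ⨾ r ⟩       ≈⟨ ⟨⟩-cong assoc assoc ⟩
        ⟨ p₂ ⨾ π₁ ⨾ r , p₂ ⨾ π₂ ⨾ r ⟩           ≈⟨ ≈.sym ⨾-⟨⟩ ⟩
        p₂ ⨾ (r ×₁ r)                           ∎

  -- Each a in the apex lies in the same fibre of l as a ⨾ l ⨾ s, so
  -- single-valuedness, applied to the pair ⟨ a , a ⨾ l ⨾ s ⟩, identifies their images under r.
  singleValued⇒factors : ∀ {X Y} {R : Span X Y} {s : Hom X (apex R)} →
                         SingleValued R → s ⨾ left R ≈ id → left R ⨾ s ⨾ right R ≈ right R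
  singleValued⇒factors {Y = Y} {R} {s} (β , _ , βr) sl≈id = from-lift (weak-universal l pair square)
    where
    l = left R
    r = right R
    open WeakPullback (WP ⟨ id , id ⟩ (l ×₁ l))
    module G = WeakPullback (WP r (id {Y}))

    pair : Hom (apex R) (apex R ⊗₀ apex R)
    pair = ⟨ id , l ⨾ s ⟩

    l⨾s⨾l≈l : (l ⨾ s) ⨾ l ≈ l
    l⨾s⨾l≈l = ≈.trans assoc (≈.trans (⨾-congˡ sl≈id) identityʳ)

    square : l ⨾ ⟨ id , id ⟩ ≈ pair ⨾ (l ×₁ l)
    square = begin
      l ⨾ ⟨ id , id ⟩                ≈⟨ ⨾-diagonal ⟩
      ⟨ l , l ⟩                      ≈⟨ ⟨⟩-cong (≈.sym identityˡ) (≈.sym l⨾s⨾l≈l) ⟩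
      ⟨ id ⨾ l , (l ⨾ s) ⨾ l ⟩       ≈⟨ ≈.sym ⟨⟩-⨾-×₁ ⟩
      pair ⨾ (l ×₁ l)                ∎

    from-lift : Σ (Hom (apex R) P) (λ v → (v ⨾ p₁ ≈ l) × (v ⨾ p₂ ≈ pair)) → l ⨾ s ⨾ r ≈ r
    from-lift (v , _ , vp₂) = begin
      l ⨾ s ⨾ r       ≈⟨ ≈.sym assoc ⟩
      (l ⨾ s) ⨾ r     ≈⟨ ≈.sym (proj₂ both) ⟩
      v ⨾ β ⨾ G.p₂    ≈⟨ proj₁ both ⟩
      id ⨾ r          ≈⟨ identityˡ ⟩
      r               ∎
      where
      both : (v ⨾ β ⨾ G.p₂ ≈ id ⨾ r) × (v ⨾ β ⨾ G.p₂ ≈ (l ⨾ s) ⨾ r)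
      both = ⟨⟩-injective (begin
        ⟨ v ⨾ β ⨾ G.p₂ , v ⨾ β ⨾ G.p₂ ⟩   ≈⟨ ≈.sym ⨾-diagonal ⟩
        (v ⨾ β ⨾ G.p₂) ⨾ ⟨ id , id ⟩      ≈⟨ ≈.trans assoc (⨾-congˡ assoc) ⟩
        v ⨾ β ⨾ G.p₂ ⨾ ⟨ id , id ⟩        ≈⟨ ⨾-congˡ βr ⟩
        v ⨾ p₂ ⨾ (r ×₁ r)                 ≈⟨ ≈.trans (≈.sym assoc) (⨾-congʳ vp₂) ⟩
        pair ⨾ (r ×₁ r)                   ≈⟨ ⟨⟩-⨾-×₁ ⟩
        ⟨ id ⨾ r , (l ⨾ s) ⨾ r ⟩          ∎)

  isMap⇔graph : ∀ {X Y} {R : Span X Y} → IsMap R ⇔ (Σ (Hom X Y) λ f → R ∼ F f)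
  isMap⇔graph {X} {Y} {R} = mk⇔ to from
    where
    to : IsMap R → Σ (Hom X Y) λ f → R ∼ F f
    to (sv , total) with Equivalence.to total⇔splitEpi-left total
    ... | s , sl≈id = s ⨾ right R
                    , Equivalence.from ≤F⇔factors (singleValued⇒factors sv sl≈id)
                    , (s , sl≈id , ≈.refl)
    from : (Σ (Hom X Y) λ f → R ∼ F f) → IsMap R
    from (f , R≤Ff , (s , sl≈id , _)) =
      factors⇒singleValued (Equivalence.to ≤F⇔factors R≤Ff) ,
      Equivalence.from total⇔splitEpi-left (s , sl≈id)

  F-isMap : ∀ {X Y} (f : Hom X Y) → IsMap (F f)
  F-isMap f = Equivalence.from isMap⇔graph (f , ∼-refl)

  F-faithful : ∀ {X Y} {f g : Hom X Y} → F f ≤ F g → f ≈ g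
  F-faithful Ff≤Fg = ≈.trans (≈.sym (Equivalence.to ≤F⇔factors Ff≤Fg)) identityˡ

  F-homomorphism : ∀ {X Y Z} (f : Hom X Y) (g : Hom Y Z) → F (f ⨾ g) ∼ (F f ⨾ˢ F g)
  F-homomorphism {Y = Y} f g with lift-along-p₁ (WP f (id {Y})) id
  ... | u , up₁ , up₂ =
    (u , ≈.trans (⨾-congˡ identityʳ) up₁ , ≈.trans (≈.sym assoc) (⨾-congʳ (≈.trans up₂ identityˡ)))
    , Equivalence.from ≤F⇔factors (begin
        (p₁ ⨾ id) ⨾ f ⨾ g   ≈⟨ ⨾-congʳ identityʳ ⟩
        p₁ ⨾ f ⨾ g          ≈⟨ ≈.sym assoc ⟩
        (p₁ ⨾ f) ⨾ g        ≈⟨ ⨾-congʳ (≈.trans commute identityʳ) ⟩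
        p₂ ⨾ g              ∎)
    where open WeakPullback (WP f (id {Y}))

  surjectiveMap⇔splitEpi : ∀ {X Y} {R : Span X Y} →
                           (IsMap R × Surjective R) ⇔ (Σ (Hom X Y) λ f → SplitEpi f × (R ∼ F f))
  surjectiveMap⇔splitEpi {X} {Y} {R} = mk⇔ to from
    where
    to : IsMap R × Surjective R → Σ (Hom X Y) λ f → SplitEpi f × (R ∼ F f)
    to (map , surjective) with Equivalence.to isMap⇔graph map
    ... | f , R∼Ff =
      f , ≤-splitEpi-right (proj₁ R∼Ff) (Equivalence.to surjective⇔splitEpi-right surjective) , R∼Ff
    from : (Σ (Hom X Y) λ f → SplitEpi f × (R ∼ F f)) → IsMap R × Surjective R
    from (f , split , R∼Ff) =
      Equivalence.from isMap⇔graph (f , R∼Ff) ,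
      Equivalence.from surjective⇔splitEpi-right (≤-splitEpi-right (proj₂ R∼Ff) split)

proposition5p5 : ∀ {o m e} (C : Category o m e) (FP : FiniteProducts C) (WP : WeakPullbacks C) →
    let open Category C
        open SpanCat C FP WP
    in
    -- F is a functor C → Span~(C) (identity on objects)
    ((∀ {X} → F (id {X}) ∼ idˢ) ×
     (∀ {X Y Z} (f : Hom X Y) (g : Hom Y Z) → F (f ⨾ g) ∼ (F f ⨾ˢ F g))) ×
    -- F lands in Map(Span~(C)) ...
    (∀ {X Y} (f : Hom X Y) → IsMap (F f)) ×
    -- ... is full onto Map(Span~(C)) ...
    (∀ {X Y} (R : Span X Y) → IsMap R → Σ (Hom X Y) λ f → R ∼ F f) ×
    -- ... and faithful: hence C ≅ Map(Span~(C))
    (∀ {X Y} (f g : Hom X Y) → F f ∼ F g → f ≈ g) ×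
    -- surjective maps are exactly the F-images of split epimorphisms
    (∀ {X Y} (R : Span X Y) → (IsMap R × Surjective R) ⇔ Σ (Hom X Y) λ f → SplitEpi f × (R ∼ F f))
proposition5p5 C FP WP =
  ( (∼-refl , F-homomorphism)
  , F-isMap
  , (λ R → Equivalence.to (isMap⇔graph {R = R}))
  , (λ f g Ff∼Fg → F-faithful (proj₁ Ff∼Fg))
  , (λ R → surjectiveMap⇔splitEpi {R = R}))
  where open MapsOfSpans C FP WP
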